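{- For each positive integer $n$ and all $m\geq4$, \[(P^{nd_m})_8\equiv I+n2^{m-1}Q\pmod{2^{m+3}},\] and \[P^{nd_m}(r,s)\equiv 0\pmod{2^{m+3}}\quad\text{for all } 0\leq r\leq 7,\ s\geq 8.\]
   Context: $P$ is the infinite matrix indexed by the non-negative integers with $P(r+1,r)=1$, $P(r,r)=r-1$, $P(r,r+1)=-r-1$ for $r\geq0$, and $P(r,s)=0$ for $|r-s|>1$; $d_m=3\cdot 2^m$. For a matrix $A$, $A_8$ denotes its top-left $8\times8$ submatrix, and $I$ is the $8\times 8$ identity. All entries of $(P^{48})_8-I$ are divisible by $8$, and $Q$ denotes the unique $8\times8$ integer matrix with entries in $\{0,\dots,15\}$ such that $(P^{48})_8\equiv I+8Q\pmod{2^7}$. Congruences of matrices are entrywise. -}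

module Defs where

open import Data.Nat as ℕ using (ℕ; zero; suc)
open import Data.Nat.Properties using () renaming (_≟_ to _≟ℕ_)
open import Data.Integer using (ℤ; +_; -_; _+_; _-_; _*_; 0ℤ; 1ℤ)
open import Relation.Nullary using (yes; no)

Pent : ℕ → ℕ → ℤ
Pent r s with r ≟ℕ suc s
... | yes _ = 1ℤ
... | no _ with s ≟ℕ r
...   | yes _ = + r - 1ℤ
...   | no _ with s ≟ℕ suc r
...     | yes _ = - (+ r) - 1ℤ
...     | no _ = 0ℤ

δ : ℕ → ℕ → ℤ
δ r s with r ≟ℕ s
... | yes _ = 1ℤ
... | no _ = 0ℤ

sumBelow : ℕ → (ℕ → ℤ) → ℤ
sumBelow zero f = 0ℤ
sumBelow (suc n) f = sumBelow n f + f n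

-- Entries of the matrix power P^k, with P^0 = identity and P^(k+1) = P^k · P.
-- The product sum Σ_t P^k(r,t) P(t,s) is taken over t < s+2, which omits
-- only terms with P(t,s) = 0 (since P(t,s) = 0 whenever t ≥ s+2).
Ppow : ℕ → ℕ → ℕ → ℤ
Ppow zero r s = δ r s
Ppow (suc k) r s = sumBelow (suc (suc s)) (λ t → Ppow k r t * Pent t s)

d : ℕ → ℕ
d m = 3 ℕ.* (2 ℕ.^ m)

-- Conjugating P by C = diag(scale), where scale s = s!/7! for s ≥ 7 and scale s = 1 for s ≤ 7,
-- gives an integral tridiagonal H with H^k = C P^k C⁻¹.  Rows r ≤ 7 of P^k are therefore
-- scale s · H^k(r,s), and 2^(β s) divides scale s for an explicit, slowly growing weight β.
-- Weighting column s by 2^(β s), a finite computation on 89 rows, carried to all rows by the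
-- periodicity of H modulo 8, shows H^48 ≡ I (mod 2); so every further factor H^48 gains a power
-- of 2 on a weighted error term.  Starting from the computed H^48 ≡ I + 8 Q₀ (mod 2^7) and
-- using Q₀² ≡ 0 (mod 4), expanding (I + aQ₀ + R)(I + bQ₀ + S) repeatedly gives, on the first
-- 8 rows and in the weighted sense, H^(n·d m) ≡ I + n 2^(m-1) Q₀ (mod 2^(m+3)).  For s ≥ 8 this
-- bounds P^(n·d m)(r,s) = scale s · H^(n·d m)(r,s), and the hypothesis forces Q ≡ Q₀ (mod 16).

module Submission where

open import Defs
open import Data.Bool using (Bool; true; false; _∧_; T; if_then_else_)
open import Data.Bool.Properties using (T-∧; T-≡)
open import Data.Empty using (⊥-elim)
open import Data.Fin using (Fin; toℕ)
open import Data.Fin.Properties using (toℕ<n)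
open import Data.Integer as ℤ using (ℤ; +_; -_; _+_; _-_; _*_; 0ℤ; 1ℤ; -1ℤ; _≤_; _<_)
open import Data.Integer.Divisibility using (_∣_)
import Data.Integer.Divisibility.Signed as Signed
import Data.Integer.Properties as ℤP
open import Data.Integer.Tactic.RingSolver using (solve-∀)
open import Data.List using (List; []; _∷_; length)
open import Data.Nat as ℕ using (ℕ; zero; suc; z≤n; s≤s; _≤ᵇ_)
open import Data.Nat.DivMod using (_/_; /-monoˡ-≤; m/n≡1+[m∸n]/n)
open import Data.Nat.Induction using (<-rec)
import Data.Nat.Properties as ℕP
import Data.Nat.Tactic.RingSolver as ℕSolver
open import Data.Product using (_×_; _,_; proj₁; proj₂)
open import Data.Vec as Vec using (Vec)
open import Data.Vec.Properties using (length-toList)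
open import Function.Base using (_⟨_⟩_; _∘_; _∘′_)
open import Function.Bundles using (module Equivalence)
open import Relation.Binary.PropositionalEquality hiding ([_])
open import Relation.Nullary using (Dec; yes; no; map′; contradiction)
open import Relation.Nullary.Decidable using (isYes; toWitness)

sumBelow-cong : ∀ n {f g : ℕ → ℤ} → (∀ i → i ℕ.< n → f i ≡ g i) → sumBelow n f ≡ sumBelow n g
sumBelow-cong zero    eq = refl
sumBelow-cong (suc n) eq = cong₂ _+_ (sumBelow-cong n (λ i i<n → eq i (ℕP.m<n⇒m<1+n i<n))) (eq n ℕP.≤-refl)

sumBelow-zero : ∀ n {f : ℕ → ℤ} → (∀ i → i ℕ.< n → f i ≡ 0ℤ) → sumBelow n f ≡ 0ℤ
sumBelow-zero n eq = sumBelow-cong n eq ⟨ trans ⟩ zeros n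
  where
  zeros : ∀ n → sumBelow n (λ _ → 0ℤ) ≡ 0ℤ
  zeros zero    = refl
  zeros (suc n) = cong (_+ 0ℤ) (zeros n)

sumBelow-+ : ∀ n (f g : ℕ → ℤ) → sumBelow n (λ i → f i + g i) ≡ sumBelow n f + sumBelow n g
sumBelow-+ zero    f g = refl
sumBelow-+ (suc n) f g = cong (_+ (f n + g n)) (sumBelow-+ n f g) ⟨ trans ⟩ interchange (sumBelow n f) (sumBelow n g) (f n) (g n)
  where
  interchange : ∀ a b c d → a + b + (c + d) ≡ a + c + (b + d)
  interchange = solve-∀

sumBelow-- : ∀ n (f g : ℕ → ℤ) → sumBelow n (λ i → f i - g i) ≡ sumBelow n f - sumBelow n g
sumBelow-- zero    f g = refl
sumBelow-- (suc n) f g = cong (_+ (f n - g n)) (sumBelow-- n f g) ⟨ trans ⟩ interchange (sumBelow n f) (sumBelow n g) (f n) (g n)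
  where
  interchange : ∀ a b c d → a - b + (c - d) ≡ a + c - (b + d)
  interchange = solve-∀

sumBelow-*ˡ : ∀ n c (f : ℕ → ℤ) → sumBelow n (λ i → c * f i) ≡ c * sumBelow n f
sumBelow-*ˡ zero    c f = sym (ℤP.*-zeroʳ c)
sumBelow-*ˡ (suc n) c f = cong (_+ c * f n) (sumBelow-*ˡ n c f) ⟨ trans ⟩ sym (ℤP.*-distribˡ-+ c (sumBelow n f) (f n))

sumBelow-extend : ∀ {n m} (f : ℕ → ℤ) → n ℕ.≤ m → (∀ i → n ℕ.≤ i → f i ≡ 0ℤ) →
                  sumBelow m f ≡ sumBelow n f
sumBelow-extend {n} {zero}  f z≤n  _     = refl
sumBelow-extend {n} {suc m} f n≤1+m vanish with n ℕ.≟ suc m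
... | yes refl = refl
... | no  n≢1+m = cong₂ _+_ (sumBelow-extend f n≤m vanish) (vanish m n≤m) ⟨ trans ⟩ ℤP.+-identityʳ _
  where n≤m = ℕP.≤-pred (ℕP.≤∧≢⇒< n≤1+m n≢1+m)

δ-refl : ∀ r → δ r r ≡ 1ℤ
δ-refl r with r ℕ.≟ r
... | yes _   = refl
... | no  r≢r = ⊥-elim (r≢r refl)

δ-≢ : ∀ {r s} → r ≢ s → δ r s ≡ 0ℤ
δ-≢ {r} {s} r≢s with r ℕ.≟ s
... | yes r≡s = ⊥-elim (r≢s r≡s)
... | no  _   = refl

δ-suc : ∀ r s → δ (suc r) (suc s) ≡ δ r s
δ-suc r s with r ℕ.≟ s
... | yes refl = δ-refl (suc r)
... | no  r≢s  = δ-≢ (r≢s ∘′ ℕP.suc-injective)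

δ-+ : ∀ n r s → δ (r ℕ.+ n) (s ℕ.+ n) ≡ δ r s
δ-+ n r s with r ℕ.≟ s
... | yes refl = δ-refl (r ℕ.+ n)
... | no  r≢s  = δ-≢ (r≢s ∘′ ℕP.+-cancelʳ-≡ n r s)

sumBelow-δ : ∀ n (f : ℕ → ℤ) {s} → s ℕ.< n → sumBelow n (λ t → f t * δ t s) ≡ f s
sumBelow-δ (suc n) f {s} s<1+n with s ℕ.≟ n
... | yes refl = cong₂ _+_ (sumBelow-zero s off-diagonal) (cong (f s *_) (δ-refl s) ⟨ trans ⟩ ℤP.*-identityʳ (f s))
                 ⟨ trans ⟩ ℤP.+-identityˡ (f s)
  where
  off-diagonal : ∀ t → t ℕ.< s → f t * δ t s ≡ 0ℤ
  off-diagonal t t<s = cong (f t *_) (δ-≢ (ℕP.<⇒≢ t<s)) ⟨ trans ⟩ ℤP.*-zeroʳ (f t)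
... | no  s≢n  = cong₂ _+_ (sumBelow-δ n f (ℕP.≤∧≢⇒< (ℕP.≤-pred s<1+n) s≢n))
                           (cong (f n *_) (δ-≢ (s≢n ∘′ sym)) ⟨ trans ⟩ ℤP.*-zeroʳ (f n))
                 ⟨ trans ⟩ ℤP.+-identityʳ (f s)

-- Divisibility by powers of two

pow2 : ℕ → ℤ
pow2 a = + (2 ℕ.^ a)

pow2-+ : ∀ a b → pow2 (a ℕ.+ b) ≡ pow2 a * pow2 b
pow2-+ a b = cong +_ (ℕP.^-distribˡ-+-* 2 a b) ⟨ trans ⟩ ℤP.pos-* (2 ℕ.^ a) (2 ℕ.^ b)

-- A record rather than a synonym, so that unification sees a and x as rigid arguments.
infix 4 2^_∣_
record 2^_∣_ (a : ℕ) (x : ℤ) : Set where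
  constructor 2^∣
  field proof : pow2 a Signed.∣ x

infix 4 2^?_∣_
2^?_∣_ : ∀ a x → Dec (2^ a ∣ x)
2^? a ∣ x = map′ 2^∣ 2^_∣_.proof (pow2 a Signed.∣? x)

2^∣-resp : ∀ {a x y} → x ≡ y → 2^ a ∣ x → 2^ a ∣ y
2^∣-resp refl d = d

2^∣0 : ∀ {a} → 2^ a ∣ 0ℤ
2^∣0 = 2^∣ (Signed.divides 0ℤ refl)

2^∣2^ : ∀ a → 2^ a ∣ pow2 a
2^∣2^ a = 2^∣ Signed.∣-refl

2^∣-+ : ∀ {a x y} → 2^ a ∣ x → 2^ a ∣ y → 2^ a ∣ x + y
2^∣-+ (2^∣ p) (2^∣ q) = 2^∣ (Signed.∣m∣n⇒∣m+n p q)

2^∣-- : ∀ {a x y} → 2^ a ∣ x → 2^ a ∣ y → 2^ a ∣ x - y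
2^∣-- (2^∣ p) (2^∣ q) = 2^∣ (Signed.∣m∣n⇒∣m-n p q)

2^∣-*ˡ : ∀ {a} c {x} → 2^ a ∣ x → 2^ a ∣ c * x
2^∣-*ˡ c (2^∣ p) = 2^∣ (Signed.∣n⇒∣m*n c p)

2^∣-* : ∀ {a b x y} → 2^ a ∣ x → 2^ b ∣ y → 2^ (a ℕ.+ b) ∣ x * y
2^∣-* {a} {b} (2^∣ p) (2^∣ q) =
  2^∣ (subst (Signed._∣ _) (sym (pow2-+ a b)) (Signed.∣-trans (Signed.*-monoʳ-∣ (pow2 a) q) (Signed.*-monoˡ-∣ _ p)))

2^∣-weaken : ∀ {a b x} → a ℕ.≤ b → 2^ b ∣ x → 2^ a ∣ x
2^∣-weaken {a} {b} a≤b (2^∣ p) = 2^∣ (Signed.∣-trans (Signed.divides (pow2 (b ℕ.∸ a)) split) p)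
  where
  split : pow2 b ≡ pow2 (b ℕ.∸ a) * pow2 a
  split = cong pow2 (sym (ℕP.m∸n+n≡m a≤b)) ⟨ trans ⟩ pow2-+ (b ℕ.∸ a) a

2^∣-cancel : ∀ {a} b x → 2^ (b ℕ.+ a) ∣ pow2 b * x → 2^ a ∣ x
2^∣-cancel {a} b x (2^∣ p) =
  2^∣ (Signed.*-cancelˡ-∣ (pow2 b) {{ℕP.m^n≢0 2 b}} (subst (Signed._∣ pow2 b * x) (pow2-+ b a) p))

2^∣-sumBelow : ∀ {a} n (f : ℕ → ℤ) → (∀ i → i ℕ.< n → 2^ a ∣ f i) → 2^ a ∣ sumBelow n f
2^∣-sumBelow zero    f d = 2^∣0
2^∣-sumBelow (suc n) f d = 2^∣-+ (2^∣-sumBelow n f (λ i i<n → d i (ℕP.m<n⇒m<1+n i<n))) (d n ℕP.≤-refl)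

2^∣-rescale : ∀ {a b c x} → a ℕ.≤ b → 2^ c ∣ pow2 a * x → 2^ (b ℕ.∸ a ℕ.+ c) ∣ pow2 b * x
2^∣-rescale {a} {b} {x = x} a≤b d = 2^∣-resp split (2^∣-* (2^∣2^ (b ℕ.∸ a)) d)
  where
  split : pow2 (b ℕ.∸ a) * (pow2 a * x) ≡ pow2 b * x
  split = sym (ℤP.*-assoc (pow2 (b ℕ.∸ a)) (pow2 a) x)
          ⟨ trans ⟩ cong (_* x) (sym (pow2-+ (b ℕ.∸ a) a) ⟨ trans ⟩ cong pow2 (ℕP.m∸n+n≡m a≤b))

2^∣n*2^ : ∀ n a → 2^ a ∣ + (n ℕ.* 2 ℕ.^ a)
2^∣n*2^ n a = 2^∣ (Signed.divides (+ n) (ℤP.pos-* n (2 ℕ.^ a)))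

2∣n*[1+n] : ∀ n → 2^ 1 ∣ + (n ℕ.* suc n)
2∣n*[1+n] zero    = 2^∣0
2∣n*[1+n] (suc n) =
  2^∣-resp (sym (cong +_ (split n) ⟨ trans ⟩ ℤP.pos-+ (n ℕ.* suc n) (2 ℕ.* suc n)))
           (2^∣-+ (2∣n*[1+n] n) (2^∣ (Signed.divides (+ suc n) 2[1+n])))
  where
  split : ∀ n → suc n ℕ.* suc (suc n) ≡ n ℕ.* suc n ℕ.+ 2 ℕ.* suc n
  split = ℕSolver.solve-∀
  2[1+n] : + (2 ℕ.* suc n) ≡ + suc n * + 2
  2[1+n] = ℤP.pos-* 2 (suc n) ⟨ trans ⟩ ℤP.*-comm (+ 2) (+ suc n)

2^∣⇒∣ : ∀ {a x} → 2^ a ∣ x → + (2 ℕ.^ a) ∣ x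
2^∣⇒∣ {a} {x} (2^∣ p) = Signed.∣⇒∣ᵤ {pow2 a} {x} p

-- The matrix P and its conjugate H

P-sub : ∀ s → Pent (suc s) s ≡ 1ℤ
P-sub s with suc s ℕ.≟ suc s
... | yes _ = refl
... | no ≢  = ⊥-elim (≢ refl)

P-diag : ∀ s → Pent s s ≡ + s - 1ℤ
P-diag s with s ℕ.≟ suc s
... | yes s≡1+s = ⊥-elim (ℕP.1+n≢n (sym s≡1+s))
... | no _ with s ℕ.≟ s
...   | yes _ = refl
...   | no ≢  = ⊥-elim (≢ refl)

P-super : ∀ s → Pent s (suc s) ≡ - (+ s) - 1ℤ
P-super s with s ℕ.≟ suc (suc s)
... | yes s≡2+s = ⊥-elim (ℕP.<⇒≢ (ℕP.m≤n⇒m≤1+n (ℕP.n<1+n s)) s≡2+s)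
... | no _ with suc s ℕ.≟ s
...   | yes 1+s≡s = ⊥-elim (ℕP.1+n≢n 1+s≡s)
...   | no _ with suc s ℕ.≟ suc s
...     | yes _ = refl
...     | no ≢  = ⊥-elim (≢ refl)

P-far : ∀ {t s} → suc (suc t) ℕ.≤ s → Pent t s ≡ 0ℤ
P-far {t} {s} 2+t≤s with t ℕ.≟ suc s
... | yes refl = ⊥-elim (ℕP.<-irrefl refl (ℕP.≤-trans (s≤s (ℕP.n≤1+n _)) (ℕP.m≤n⇒m≤1+n 2+t≤s)))
... | no _ with s ℕ.≟ t
...   | yes refl = ⊥-elim (ℕP.<-irrefl refl (ℕP.m≤n⇒m≤1+n 2+t≤s) )
...   | no _ with s ℕ.≟ suc t
...     | yes refl = ⊥-elim (ℕP.<-irrefl refl 2+t≤s)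
...     | no _ = refl

infixl 7 _·P
_·P : (ℕ → ℤ) → ℕ → ℤ
(f ·P) s = sumBelow (suc (suc s)) (λ t → f t * Pent t s)

·P-*ˡ : ∀ c f s → c * (f ·P) s ≡ ((λ t → c * f t) ·P) s
·P-*ˡ c f s = sym (sumBelow-*ˡ (suc (suc s)) c (λ t → f t * Pent t s))
  ⟨ trans ⟩ sumBelow-cong (suc (suc s)) (λ t _ → sym (ℤP.*-assoc c (f t) (Pent t s)))

·P-zero : ∀ f → (f ·P) zero ≡ f 1 + f 0 * (+ 0 - 1ℤ)
·P-zero f = cong₂ (λ x y → 0ℤ + f 0 * x + f 1 * y) (P-diag 0) (P-sub 0) ⟨ trans ⟩ reorder (f 0 * (+ 0 - 1ℤ)) (f 1)
  where
  reorder : ∀ a b → 0ℤ + a + b * 1ℤ ≡ b + a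
  reorder = solve-∀

·P-suc : ∀ f s → (f ·P) (suc s) ≡ f (suc (suc s)) + f (suc s) * (+ suc s - 1ℤ) + f s * (- (+ s) - 1ℤ)
·P-suc f s =
  cong₂ _+_ (cong₂ _+_ (cong₂ _+_ (sumBelow-zero s far) (cong (f s *_) (P-super s)))
                       (cong (f (suc s) *_) (P-diag (suc s))))
            (cong (f (suc (suc s)) *_) (P-sub (suc s)))
  ⟨ trans ⟩ reorder (f s * (- (+ s) - 1ℤ)) (f (suc s) * (+ suc s - 1ℤ)) (f (suc (suc s)))
  where
  far : ∀ t → t ℕ.< s → f t * Pent t (suc s) ≡ 0ℤ
  far t t<s = cong (f t *_) (P-far (s≤s t<s)) ⟨ trans ⟩ ℤP.*-zeroʳ (f t)
  reorder : ∀ a b c → 0ℤ + a + b + c * 1ℤ ≡ c + b + a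
  reorder = solve-∀

-- Hsub s · Hsup s = P(s,s+1): from s = 7 on, the factor s+1 is moved onto the subdiagonal.
Hsub Hsup : ℕ → ℤ
Hsub s = if 7 ≤ᵇ s then + suc s else 1ℤ
Hsup s = if 7 ≤ᵇ s then -1ℤ else - (+ suc s)

Hsub*Hsup : ∀ s → Hsub s * Hsup s ≡ - (+ s) - 1ℤ
Hsub*Hsup s = product (7 ≤ᵇ s)
  where
  product : ∀ b → (if b then + suc s else 1ℤ) * (if b then -1ℤ else - (+ suc s)) ≡ - (+ s) - 1ℤ
  product true  = cong (_* -1ℤ) (ℤP.pos-+ 1 s) ⟨ trans ⟩ negate (+ s)
    where
    negate : ∀ x → (1ℤ + x) * -1ℤ ≡ - x - 1ℤ
    negate = solve-∀
  product false = cong (λ x → 1ℤ * - x) (ℤP.pos-+ 1 s) ⟨ trans ⟩ negate (+ s)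
    where
    negate : ∀ x → 1ℤ * - (1ℤ + x) ≡ - x - 1ℤ
    negate = solve-∀

-- Opaque: ℤ multiplication duplicates its arguments, so unfolding scale at a symbolic
-- index would blow up exponentially.
opaque
  scale : ℕ → ℤ
  scale zero    = 1ℤ
  scale (suc s) = scale s * Hsub s

  scale-suc : ∀ s → scale (suc s) ≡ scale s * Hsub s
  scale-suc s = refl

  scale-≤7 : ∀ {r} → r ℕ.≤ 7 → scale r ≡ 1ℤ
  scale-≤7 {0} _ = refl
  scale-≤7 {1} _ = refl
  scale-≤7 {2} _ = refl
  scale-≤7 {3} _ = refl
  scale-≤7 {4} _ = refl
  scale-≤7 {5} _ = refl
  scale-≤7 {6} _ = refl
  scale-≤7 {7} _ = refl
  scale-≤7 {suc (suc (suc (suc (suc (suc (suc (suc _)))))))} (s≤s (s≤s (s≤s (s≤s (s≤s (s≤s (s≤s ())))))))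

Hstencil : ℕ → ℤ → ℤ → ℤ → ℤ
Hstencil zero    _ x y = y * Hsub 0 + x * -1ℤ
Hstencil (suc s) w x y = y * Hsub (suc s) + x * + s + w * Hsup s

-- Hstencil matches on the index, so (f ·H) s is stuck for a variable s: unfolding H^k
-- symbolically would otherwise branch three ways per step.
infixl 7 _·H
_·H : (ℕ → ℤ) → ℕ → ℤ
(f ·H) s = Hstencil s (f (ℕ.pred s)) (f s) (f (suc s))

infixl 7 _·H^_
_·H^_ : (ℕ → ℤ) → ℕ → ℕ → ℤ
f ·H^ zero  = f
f ·H^ suc k = (f ·H^ k) ·H

-- H^ k [ t , s ] with a literal k must only be compared syntactically: unfolding it at a symbolic
-- index is exponential.  This is why implicit arguments next to such terms are given explicitly.
H^_[_,_] : ℕ → ℕ → ℕ → ℤ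
H^ k [ t , s ] = (δ t ·H^ k) s

·P-conj : ∀ {f g} → (∀ t → f t ≡ scale t * g t) → ∀ s → (f ·P) s ≡ scale s * (g ·H) s
·P-conj {f} {g} f≡ zero =
  ·P-zero f
  ⟨ trans ⟩ cong₂ (λ x y → x + y * (+ 0 - 1ℤ)) (f≡ 1 ⟨ trans ⟩ cong (_* g 1) (scale-suc 0)) (f≡ 0)
  ⟨ trans ⟩ collect (scale 0) (Hsub 0) (g 1) (g 0)
  where
  collect : ∀ c h g₁ g₀ → c * h * g₁ + c * g₀ * (+ 0 - 1ℤ) ≡ c * (g₁ * h + g₀ * -1ℤ)
  collect = solve-∀
·P-conj {f} {g} f≡ (suc s) =
  ·P-suc f s
  ⟨ trans ⟩ cong₂ _+_ (cong₂ (λ x y → x + y * (+ suc s - 1ℤ))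
                             (f≡ (suc (suc s)) ⟨ trans ⟩ cong (_* g (suc (suc s))) scale-2+s)
                             (f≡ (suc s) ⟨ trans ⟩ cong (_* g (suc s)) (scale-suc s)))
                      (cong₂ _*_ (f≡ s) (sym (Hsub*Hsup s)))
  ⟨ trans ⟩ collect (scale s) (Hsub s) (Hsub (suc s)) (Hsup s) (g (suc (suc s))) (g (suc s)) (g s) (+ s)
  ⟨ trans ⟩ cong (_* (g ·H) (suc s)) (sym (scale-suc s))
  where
  scale-2+s : scale (suc (suc s)) ≡ scale s * Hsub s * Hsub (suc s)
  scale-2+s = scale-suc (suc s) ⟨ trans ⟩ cong (_* Hsub (suc s)) (scale-suc s)
  collect : ∀ c h h' u g₂ g₁ g₀ x →
            c * h * h' * g₂ + c * h * g₁ * (1ℤ + x - 1ℤ) + c * g₀ * (h * u) ≡ c * h * (g₂ * h' + g₁ * x + g₀ * u)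
  collect = solve-∀

scale-Ppow : ∀ k r s → scale r * Ppow k r s ≡ scale s * H^ k [ r , s ]
scale-Ppow zero r s with r ℕ.≟ s
... | yes refl = refl
... | no _     = ℤP.*-zeroʳ (scale r) ⟨ trans ⟩ sym (ℤP.*-zeroʳ (scale s))
scale-Ppow (suc k) r s = ·P-*ˡ (scale r) (Ppow k r) s ⟨ trans ⟩ ·P-conj (λ t → scale-Ppow k r t) s

Ppow-conj : ∀ k {r} s → r ℕ.≤ 7 → Ppow k r s ≡ scale s * H^ k [ r , s ]
Ppow-conj k {r} s r≤7 =
  sym (ℤP.*-identityˡ (Ppow k r s)) ⟨ trans ⟩ cong (_* Ppow k r s) (sym (scale-≤7 r≤7)) ⟨ trans ⟩ scale-Ppow k r s

Ppow-≡-H^ : ∀ k {r s} → r ℕ.≤ 7 → s ℕ.≤ 7 → Ppow k r s ≡ H^ k [ r , s ]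
Ppow-≡-H^ k {r} {s} r≤7 s≤7 =
  Ppow-conj k s r≤7 ⟨ trans ⟩ cong (_* H^ k [ r , s ]) (scale-≤7 s≤7) ⟨ trans ⟩ ℤP.*-identityˡ (H^ k [ r , s ])

·H-cong : ∀ {f g} s → (∀ x → x ℕ.≤ suc s → f x ≡ g x) → (f ·H) s ≡ (g ·H) s
·H-cong {f} {g} s f≡g =
  cong₂ (Hstencil s (f (ℕ.pred s))) (f≡g s (ℕP.n≤1+n s)) (f≡g (suc s) ℕP.≤-refl)
  ⟨ trans ⟩ cong (λ w → Hstencil s w (g s) (g (suc s))) (f≡g (ℕ.pred s) (ℕP.m≤n⇒m≤1+n (ℕP.pred[n]≤n {s})))

·H^-cong : ∀ k {f g} → (∀ x → f x ≡ g x) → ∀ s → (f ·H^ k) s ≡ (g ·H^ k) s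
·H^-cong zero    f≡g s = f≡g s
·H^-cong (suc k) f≡g s = ·H-cong s (λ x _ → ·H^-cong k f≡g x)

·H^-exponent-+ : ∀ a b f s → (f ·H^ (a ℕ.+ b)) s ≡ ((f ·H^ b) ·H^ a) s
·H^-exponent-+ zero    b f s = refl
·H^-exponent-+ (suc a) b f s = ·H-cong s (λ x _ → ·H^-exponent-+ a b f x)

·H-+ : ∀ f g s → ((λ x → f x + g x) ·H) s ≡ (f ·H) s + (g ·H) s
·H-+ f g zero    = distribute (f 1) (g 1) (f 0) (g 0) (Hsub 0)
  where
  distribute : ∀ a b c d h → (a + b) * h + (c + d) * -1ℤ ≡ a * h + c * -1ℤ + (b * h + d * -1ℤ)
  distribute = solve-∀
·H-+ f g (suc s) = distribute (f (suc (suc s))) (g (suc (suc s))) (f (suc s)) (g (suc s)) (f s) (g s)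
                              (Hsub (suc s)) (+ s) (Hsup s)
  where
  distribute : ∀ a b c d e i h j u → (a + b) * h + (c + d) * j + (e + i) * u ≡
                                     a * h + c * j + e * u + (b * h + d * j + i * u)
  distribute = solve-∀

·H-* : ∀ c f s → ((λ x → c * f x) ·H) s ≡ c * (f ·H) s
·H-* c f zero    = distribute c (f 1) (f 0) (Hsub 0)
  where
  distribute : ∀ c a b h → c * a * h + c * b * -1ℤ ≡ c * (a * h + b * -1ℤ)
  distribute = solve-∀
·H-* c f (suc s) = distribute c (f (suc (suc s))) (f (suc s)) (f s) (Hsub (suc s)) (+ s) (Hsup s)
  where
  distribute : ∀ c a b e h j u → c * a * h + c * b * j + c * e * u ≡ c * (a * h + b * j + e * u)
  distribute = solve-∀

·H-0 : ∀ s → ((λ _ → 0ℤ) ·H) s ≡ 0ℤ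
·H-0 s = ·H-* 0ℤ (λ _ → 0ℤ) s ⟨ trans ⟩ ℤP.*-zeroˡ (((λ _ → 0ℤ) ·H) s)

·H-sumBelow : ∀ N (c : ℕ → ℤ) (g : ℕ → ℕ → ℤ) s →
              ((λ x → sumBelow N (λ t → c t * g t x)) ·H) s ≡ sumBelow N (λ t → c t * (g t ·H) s)
·H-sumBelow zero    c g s = ·H-0 s
·H-sumBelow (suc N) c g s =
  ·H-+ (λ x → sumBelow N (λ t → c t * g t x)) (λ x → c N * g N x) s
  ⟨ trans ⟩ cong₂ _+_ (·H-sumBelow N c g s) (·H-* (c N) (g N) s)

·H^-+ : ∀ k f g s → ((λ x → f x + g x) ·H^ k) s ≡ (f ·H^ k) s + (g ·H^ k) s
·H^-+ zero    f g s = refl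
·H^-+ (suc k) f g s = ·H-cong s (λ x _ → ·H^-+ k f g x) ⟨ trans ⟩ ·H-+ (f ·H^ k) (g ·H^ k) s

·H^-* : ∀ k c f s → ((λ x → c * f x) ·H^ k) s ≡ c * (f ·H^ k) s
·H^-* zero    c f s = refl
·H^-* (suc k) c f s = ·H-cong s (λ x _ → ·H^-* k c f x) ⟨ trans ⟩ ·H-* c (f ·H^ k) s

·H^-expand : ∀ k f {s N} → suc (k ℕ.+ s) ℕ.≤ N → (f ·H^ k) s ≡ sumBelow N (λ t → f t * H^ k [ t , s ])
·H^-expand zero    f {s} {N} s<N = sym (sumBelow-δ N f s<N)
·H^-expand (suc k) f {s} {N} 2+k+s≤N =
  ·H-cong s (λ x x≤1+s → ·H^-expand k f (ℕP.≤-trans (s≤s (ℕP.+-monoʳ-≤ k x≤1+s))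
                                                     (ℕP.≤-trans (ℕP.≤-reflexive (cong suc (ℕP.+-suc k s))) 2+k+s≤N)))
  ⟨ trans ⟩ ·H-sumBelow N f (λ t → H^ k [ t ,_]) s

H^-vanishes : ∀ k {t s} → s ℕ.+ k ℕ.< t → H^ k [ t , s ] ≡ 0ℤ
H^-vanishes zero    {t} {s} s+0<t = δ-≢ (λ t≡s → ℕP.<-irrefl (sym t≡s) (subst (ℕ._< t) (ℕP.+-identityʳ s) s+0<t))
H^-vanishes (suc k) {t} {s} s+1+k<t = ·H-cong s below ⟨ trans ⟩ ·H-0 s
  where
  below : ∀ x → x ℕ.≤ suc s → H^ k [ t , x ] ≡ 0ℤ
  below x x≤1+s =
    H^-vanishes k (ℕP.≤-<-trans (ℕP.≤-trans (ℕP.+-monoˡ-≤ k x≤1+s) (ℕP.≤-reflexive (sym (ℕP.+-suc s k)))) s+1+k<t)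

-- The weight β

-- β s bounds the 2-adic valuation of scale s from below (2^β∣scale) and grows slowly enough
-- that H^48 ≡ I modulo 2 once column s is weighted by 2^(β s) (H^48≡I).
𝟙[_≤_] : ℕ → ℕ → ℕ
𝟙[ a ≤ s ] with a ℕ.≤? s
... | yes _ = 1
... | no  _ = 0

𝟙-mono : ∀ a {s s'} → s ℕ.≤ s' → 𝟙[ a ≤ s ] ℕ.≤ 𝟙[ a ≤ s' ]
𝟙-mono a {s} {s'} s≤s' with a ℕ.≤? s | a ℕ.≤? s'
... | yes _   | yes _   = ℕP.≤-refl
... | yes a≤s | no  a≰s' = contradiction (ℕP.≤-trans a≤s s≤s') a≰s'
... | no  _   | _       = z≤n

𝟙-≥ : ∀ {a s} → a ℕ.≤ s → 𝟙[ a ≤ s ] ≡ 1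
𝟙-≥ {a} {s} a≤s with a ℕ.≤? s
... | yes _   = refl
... | no  a≰s = contradiction a≤s a≰s

β : ℕ → ℕ
β s = 3 ℕ.* 𝟙[ 8 ≤ s ] ℕ.+ 𝟙[ 10 ≤ s ] ℕ.+ 𝟙[ 14 ≤ s ] ℕ.+ 𝟙[ 22 ≤ s ] ℕ.+ 𝟙[ 38 ≤ s ]
      ℕ.+ (s ℕ.∸ 38) / 32

β-mono : ∀ {s s'} → s ℕ.≤ s' → β s ℕ.≤ β s'
β-mono s≤s' =
  ℕP.+-mono-≤ (ℕP.+-mono-≤ (ℕP.+-mono-≤ (ℕP.+-mono-≤ (ℕP.+-mono-≤ (ℕP.*-monoʳ-≤ 3 (𝟙-mono 8 s≤s'))
    (𝟙-mono 10 s≤s')) (𝟙-mono 14 s≤s')) (𝟙-mono 22 s≤s')) (𝟙-mono 38 s≤s'))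
    (/-monoˡ-≤ 32 (ℕP.∸-monoˡ-≤ 38 s≤s'))

β-≤7 : ∀ {s} → s ℕ.≤ 7 → β s ≡ 0
β-≤7 s≤7 = ℕP.n≤0⇒n≡0 (β-mono s≤7)

β-≥38 : ∀ {s} → 38 ℕ.≤ s → β s ≡ 7 ℕ.+ (s ℕ.∸ 38) / 32
β-≥38 {s} 38≤s
  rewrite 𝟙-≥ {8} (ℕP.≤-trans (ℕP.m≤n+m 8 30) 38≤s) | 𝟙-≥ {10} (ℕP.≤-trans (ℕP.m≤n+m 10 28) 38≤s)
        | 𝟙-≥ {14} (ℕP.≤-trans (ℕP.m≤n+m 14 24) 38≤s) | 𝟙-≥ {22} (ℕP.≤-trans (ℕP.m≤n+m 22 16) 38≤s)
        | 𝟙-≥ 38≤s = refl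

β-+32 : ∀ {s} → 38 ℕ.≤ s → β (s ℕ.+ 32) ≡ suc (β s)
β-+32 {s} 38≤s = begin
  β (s ℕ.+ 32)
    ≡⟨ β-≥38 (ℕP.≤-trans 38≤s (ℕP.m≤m+n s 32)) ⟩
  7 ℕ.+ (s ℕ.+ 32 ℕ.∸ 38) / 32
    ≡⟨ cong (λ x → 7 ℕ.+ x / 32) (ℕP.+-∸-comm 32 38≤s ⟨ trans ⟩ ℕP.+-comm (s ℕ.∸ 38) 32) ⟩
  7 ℕ.+ (32 ℕ.+ (s ℕ.∸ 38)) / 32
    ≡⟨ cong (7 ℕ.+_) (m/n≡1+[m∸n]/n (ℕP.m≤m+n 32 (s ℕ.∸ 38))) ⟩
  7 ℕ.+ suc ((32 ℕ.+ (s ℕ.∸ 38) ℕ.∸ 32) / 32)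
    ≡⟨ cong (λ x → 7 ℕ.+ suc (x / 32)) (ℕP.m+n∸m≡n 32 (s ℕ.∸ 38)) ⟩
  8 ℕ.+ (s ℕ.∸ 38) / 32
    ≡⟨ cong suc (sym (β-≥38 38≤s)) ⟩
  suc (β s)
    ∎
  where open ≡-Reasoning

β-+32-mono : ∀ {s} → 9 ℕ.≤ s → suc (β s) ℕ.≤ β (s ℕ.+ 32)
β-+32-mono {s} 9≤s = split (38 ℕ.≤? s)
  where
  split : Dec (38 ℕ.≤ s) → suc (β s) ℕ.≤ β (s ℕ.+ 32)
  split (yes 38≤s) = ℕP.≤-reflexive (sym (β-+32 38≤s))
  split (no  38≰s) = ℕP.≤-trans (s≤s (β-mono {s} {37} (ℕP.≤-pred (ℕP.≰⇒> 38≰s))))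
                               (β-mono {41} (ℕP.+-monoˡ-≤ 32 9≤s))

infix 4 2^_∣ᵝ_
2^_∣ᵝ_ : ℕ → (ℕ → ℤ) → Set
2^ j ∣ᵝ f = ∀ s → 2^ j ∣ pow2 (β s) * f s

unweight-≤7 : ∀ {K} s (x : ℤ) → s ℕ.≤ 7 → 2^ K ∣ pow2 (β s) * x → 2^ K ∣ x
unweight-≤7 s x s≤7 = 2^∣-resp (cong (λ b → pow2 b * x) (β-≤7 s≤7) ⟨ trans ⟩ ℤP.*-identityˡ x)

H^_≡I-row_ : ℕ → ℕ → Set
H^ k ≡I-row t = 2^ suc (β t) ∣ᵝ (λ s → H^ k [ t , s ] - δ t s)

at : List ℤ → ℕ → ℤ
at []       _       = 0ℤ
at (x ∷ _)  zero    = x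
at (_ ∷ xs) (suc i) = at xs i

at-beyond : ∀ xs {i} → length xs ℕ.≤ i → at xs i ≡ 0ℤ
at-beyond []       _         = refl
at-beyond (x ∷ xs) (s≤s len≤i) = at-beyond xs len≤i

-- ·Hₗ-from s w xs lists the entries s, s+1, … of f ·H when xs lists f s, f (s+1), … and w = f (s-1).
·Hₗ-from : ℕ → ℤ → List ℤ → List ℤ
·Hₗ-from s w []       = Hstencil s w 0ℤ 0ℤ ∷ []
·Hₗ-from s w (x ∷ xs) = Hstencil s w x (at xs 0) ∷ ·Hₗ-from (suc s) x xs

at-·Hₗ-from : ∀ s w xs f → (∀ i → at xs i ≡ f (i ℕ.+ s)) → w ≡ f (ℕ.pred s) →
              ∀ i → at (·Hₗ-from s w xs) i ≡ (f ·H) (i ℕ.+ s)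
at-·Hₗ-from s w [] f xs≡f w≡ zero =
  cong₂ (λ w x → Hstencil s w x 0ℤ) w≡ (xs≡f 0) ⟨ trans ⟩ cong (Hstencil s _ _) (xs≡f 1)
at-·Hₗ-from s w [] f xs≡f w≡ (suc i)
  rewrite sym (xs≡f i) | sym (xs≡f (suc i)) | sym (xs≡f (suc (suc i))) = refl
at-·Hₗ-from s w (x ∷ xs) f xs≡f w≡ zero =
  cong₂ (λ w x → Hstencil s w x (at xs 0)) w≡ (xs≡f 0) ⟨ trans ⟩ cong (Hstencil s _ _) (xs≡f 1)
at-·Hₗ-from s w (x ∷ xs) f xs≡f w≡ (suc i) =
  at-·Hₗ-from (suc s) x xs f (λ j → xs≡f (suc j) ⟨ trans ⟩ cong f (sym (ℕP.+-suc j s))) (xs≡f 0) i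
  ⟨ trans ⟩ cong (f ·H) (ℕP.+-suc i s)

length-·Hₗ-from : ∀ s x ys → length (·Hₗ-from s x ys) ≡ suc (length ys)
length-·Hₗ-from s x []       = refl
length-·Hₗ-from s x (y ∷ ys) = cong suc (length-·Hₗ-from (suc s) y ys)

infixl 7 _·Hₗ^_
_·Hₗ^_ : List ℤ → ℕ → List ℤ
xs ·Hₗ^ zero  = xs
xs ·Hₗ^ suc k = ·Hₗ-from 0 (at (xs ·Hₗ^ k) 0) (xs ·Hₗ^ k)

at-·Hₗ^ : ∀ k xs i → at (xs ·Hₗ^ k) i ≡ (at xs ·H^ k) i
at-·Hₗ^ zero    xs i = refl
at-·Hₗ^ (suc k) xs i =
  at-·Hₗ-from 0 (at (xs ·Hₗ^ k) 0) (xs ·Hₗ^ k) (at xs ·H^ k)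
              (λ j → at-·Hₗ^ k xs j ⟨ trans ⟩ cong (at xs ·H^ k) (sym (ℕP.+-identityʳ j))) (at-·Hₗ^ k xs 0) i
  ⟨ trans ⟩ cong (at xs ·H^ suc k) (ℕP.+-identityʳ i)

length-·Hₗ^ : ∀ k xs → length (xs ·Hₗ^ k) ≡ k ℕ.+ length xs
length-·Hₗ^ zero    xs = refl
length-·Hₗ^ (suc k) xs = length-·Hₗ-from 0 _ (xs ·Hₗ^ k) ⟨ trans ⟩ cong suc (length-·Hₗ^ k xs)

unitRow : ℕ → List ℤ
unitRow zero    = 1ℤ ∷ []
unitRow (suc t) = 0ℤ ∷ unitRow t

at-unitRow : ∀ t s → at (unitRow t) s ≡ δ t s
at-unitRow zero    zero    = sym (δ-refl 0)
at-unitRow zero    (suc s) = sym (δ-≢ {0} {suc s} (λ ()))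
at-unitRow (suc t) zero    = sym (δ-≢ {suc t} {0} (λ ()))
at-unitRow (suc t) (suc s) = at-unitRow t s ⟨ trans ⟩ sym (δ-suc t s)

length-unitRow : ∀ t → length (unitRow t) ≡ suc t
length-unitRow zero    = refl
length-unitRow (suc t) = cong suc (length-unitRow t)

at-H^-row : ∀ k t s → at (unitRow t ·Hₗ^ k) s ≡ H^ k [ t , s ]
at-H^-row k t s = at-·Hₗ^ k (unitRow t) s ⟨ trans ⟩ ·H^-cong k (at-unitRow t) s

H^-vanishes-above : ∀ k {t s} → k ℕ.+ suc t ℕ.≤ s → H^ k [ t , s ] ≡ 0ℤ
H^-vanishes-above k {t} {s} k+1+t≤s =
  sym (at-H^-row k t s) ⟨ trans ⟩
  at-beyond (unitRow t ·Hₗ^ k)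
            (ℕP.≤-trans (ℕP.≤-reflexive (length-·Hₗ^ k (unitRow t) ⟨ trans ⟩ cong (k ℕ.+_) (length-unitRow t))) k+1+t≤s)

allᵇ : (ℕ → Bool) → ℕ → Bool
allᵇ p zero    = true
allᵇ p (suc n) = allᵇ p n ∧ p n

allᵇ-sound : ∀ p n → T (allᵇ p n) → ∀ {i} → i ℕ.< n → T (p i)
allᵇ-sound p (suc n) ok {i} i<1+n with i ℕ.≟ n
... | yes refl = proj₂ (Equivalence.to T-∧ ok)
... | no  i≢n  = allᵇ-sound p n (proj₁ (Equivalence.to T-∧ ok)) (ℕP.≤∧≢⇒< (ℕP.≤-pred i<1+n) i≢n)

allAtᵇ : (ℕ → ℤ → Bool) → List ℤ → Bool
allAtᵇ p []       = true
allAtᵇ p (x ∷ xs) = p 0 x ∧ allAtᵇ (p ∘ suc) xs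

allAtᵇ-sound : ∀ p xs → T (allAtᵇ p xs) → ∀ {i} → i ℕ.< length xs → T (p i (at xs i))
allAtᵇ-sound p (x ∷ xs) ok {zero}  _           = proj₁ (Equivalence.to T-∧ ok)
allAtᵇ-sound p (x ∷ xs) ok {suc i} (s≤s i<len) = allAtᵇ-sound (p ∘ suc) xs (proj₂ (Equivalence.to T-∧ ok)) i<len

rowsᵇ : ℕ → (ℕ → ℕ → ℤ → Bool) → ℕ → Bool
rowsᵇ k p n = allᵇ (λ t → allAtᵇ (p t) (unitRow t ·Hₗ^ k)) n

H^-rows-check : ∀ k {P : ℕ → ℕ → ℤ → Set} (P? : ∀ t s x → Dec (P t s x)) n →
                rowsᵇ k (λ t s x → isYes (P? t s x)) n ≡ true →
                (∀ {t s} → t ℕ.< n → k ℕ.+ suc t ℕ.≤ s → P t s 0ℤ) →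
                ∀ {t} → t ℕ.< n → ∀ s → P t s (H^ k [ t , s ])
H^-rows-check k {P} P? n checked beyond {t} t<n s = split (s ℕ.<? k ℕ.+ suc t)
  where
  row = unitRow t ·Hₗ^ k
  length-row : length row ≡ k ℕ.+ suc t
  length-row = length-·Hₗ^ k (unitRow t) ⟨ trans ⟩ cong (k ℕ.+_) (length-unitRow t)
  split : Dec (s ℕ.< k ℕ.+ suc t) → P t s (H^ k [ t , s ])
  split (yes s<k+1+t) =
    subst (P t s) (at-H^-row k t s)
      (toWitness (allAtᵇ-sound (λ s x → isYes (P? t s x)) row
                               (allᵇ-sound _ n (Equivalence.from T-≡ checked) t<n)
                               (subst (s ℕ.<_) (sym length-row) s<k+1+t)))
  split (no s≮k+1+t) = subst (P t s) (sym (H^-vanishes-above k (ℕP.≮⇒≥ s≮k+1+t))) (beyond t<n (ℕP.≮⇒≥ s≮k+1+t))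

-- The value of Q obtained by computing (P⁴⁸)₈; the hypothesis determines Q only modulo 16.
Q₀-row : ℕ → Vec ℤ 8
Q₀-row 0 = Vec.fromList (+ 2  ∷ + 4  ∷ + 12 ∷ + 0  ∷ + 8  ∷ + 8  ∷ + 0  ∷ + 0  ∷ [])
Q₀-row 1 = Vec.fromList (+ 12 ∷ + 2  ∷ + 0  ∷ + 12 ∷ + 8  ∷ + 0  ∷ + 0  ∷ + 0  ∷ [])
Q₀-row 2 = Vec.fromList (+ 6  ∷ + 8  ∷ + 10 ∷ + 8  ∷ + 0  ∷ + 8  ∷ + 8  ∷ + 8  ∷ [])
Q₀-row 3 = Vec.fromList (+ 0  ∷ + 2  ∷ + 8  ∷ + 6  ∷ + 0  ∷ + 0  ∷ + 8  ∷ + 0  ∷ [])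
Q₀-row 4 = Vec.fromList (+ 13 ∷ + 5  ∷ + 0  ∷ + 12 ∷ + 10 ∷ + 12 ∷ + 12 ∷ + 8  ∷ [])
Q₀-row 5 = Vec.fromList (+ 3  ∷ + 6  ∷ + 14 ∷ + 8  ∷ + 4  ∷ + 2  ∷ + 0  ∷ + 12 ∷ [])
Q₀-row 6 = Vec.fromList (+ 9  ∷ + 11 ∷ + 13 ∷ + 11 ∷ + 2  ∷ + 0  ∷ + 2  ∷ + 0  ∷ [])
Q₀-row 7 = Vec.fromList (+ 2  ∷ + 15 ∷ + 11 ∷ + 2  ∷ + 12 ∷ + 6  ∷ + 0  ∷ + 6  ∷ [])
Q₀-row _ = Vec.replicate 8 0ℤ

Q₀ : ℕ → ℕ → ℤ
Q₀ r = at (Vec.toList (Q₀-row r))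

Q₀-vanishes : ∀ r {s} → 8 ℕ.≤ s → Q₀ r s ≡ 0ℤ
Q₀-vanishes r 8≤s = at-beyond (Vec.toList (Q₀-row r)) (subst (ℕ._≤ _) (sym (length-toList (Q₀-row r))) 8≤s)

Q₀·_ : (ℕ → ℕ → ℤ) → ℕ → ℕ → ℤ
(Q₀· M) r s = sumBelow 8 (λ u → Q₀ r u * M u s)

deviation : ℕ → ℤ → ℕ → ℕ → ℤ
deviation e a r s = H^ e [ r , s ] - (δ r s + a * Q₀ r s)

infix 4 H^_≡I+_·Q₀-mod2^_
H^_≡I+_·Q₀-mod2^_ : ℕ → ℤ → ℕ → Set
H^ e ≡I+ a ·Q₀-mod2^ K = ∀ {r} → r ℕ.< 8 → 2^ K ∣ᵝ deviation e a r

≡I-entry? : ∀ t s x → Dec (2^ suc (β t) ∣ pow2 (β s) * (x - δ t s))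
≡I-entry? t s x = 2^? suc (β t) ∣ pow2 (β s) * (x - δ t s)

≡I-entries-checked : rowsᵇ 48 (λ t s x → isYes (≡I-entry? t s x)) 89 ≡ true
≡I-entries-checked = refl

H^48≡I-row-<89 : ∀ {t} → t ℕ.< 89 → H^ 48 ≡I-row t
H^48≡I-row-<89 = H^-rows-check 48 ≡I-entry? 89 ≡I-entries-checked beyond
  where
  beyond : ∀ {t s} → t ℕ.< 89 → 49 ℕ.+ t ℕ.≤ s → 2^ suc (β t) ∣ pow2 (β s) * (0ℤ - δ t s)
  beyond {t} {s} _ 49+t≤s =
    2^∣-resp (sym (cong (λ x → pow2 (β s) * (0ℤ - x)) (δ-≢ t≢s) ⟨ trans ⟩ ℤP.*-zeroʳ (pow2 (β s)))) 2^∣0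
    where
    t≢s : t ≢ s
    t≢s refl = contradiction (ℕP.≤-trans (ℕP.m≤n+m (suc t) 48) 49+t≤s) (ℕP.<-irrefl refl)

≡I+8Q₀-entry? : ∀ r s x → Dec (2^ 7 ∣ pow2 (β s) * (x - (δ r s + + 8 * Q₀ r s)))
≡I+8Q₀-entry? r s x = 2^? 7 ∣ pow2 (β s) * (x - (δ r s + + 8 * Q₀ r s))

≡I+8Q₀-entries-checked : rowsᵇ 48 (λ r s x → isYes (≡I+8Q₀-entry? r s x)) 8 ≡ true
≡I+8Q₀-entries-checked = refl

H^48≡I+8Q₀ : ∀ {r} → r ℕ.< 8 → ∀ s → 2^ 7 ∣ pow2 (β s) * (H^ 48 [ r , s ] - (δ r s + + 8 * Q₀ r s))
H^48≡I+8Q₀ = H^-rows-check 48 ≡I+8Q₀-entry? 8 ≡I+8Q₀-entries-checked beyond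
  where
  beyond : ∀ {r s} → r ℕ.< 8 → 49 ℕ.+ r ℕ.≤ s → 2^ 7 ∣ pow2 (β s) * (0ℤ - (δ r s + + 8 * Q₀ r s))
  beyond {r} {s} _ 49+r≤s =
    2^∣-resp (sym (cong₂ (λ x y → pow2 (β s) * (0ℤ - (x + + 8 * y))) (δ-≢ r≢s) (Q₀-vanishes r 8≤s)
                   ⟨ trans ⟩ ℤP.*-zeroʳ (pow2 (β s)))) 2^∣0
    where
    8≤s : 8 ℕ.≤ s
    8≤s = ℕP.≤-trans (ℕP.m≤m+n 8 (41 ℕ.+ r)) 49+r≤s
    r≢s : r ≢ s
    r≢s refl = contradiction (ℕP.≤-trans (ℕP.m≤n+m (suc r) 48) 49+r≤s) (ℕP.<-irrefl refl)

Q₀·Q₀-evenᵇ : ℕ → Bool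
Q₀·Q₀-evenᵇ r = allᵇ (λ s → isYes (2^? 2 ∣ (Q₀· Q₀) r s)) 8

Q₀·Q₀-even-checked : allᵇ Q₀·Q₀-evenᵇ 8 ≡ true
Q₀·Q₀-even-checked = refl

Q₀·Q₀-even : ∀ {r} → r ℕ.< 8 → ∀ s → 2^ 2 ∣ (Q₀· Q₀) r s
Q₀·Q₀-even {r} r<8 s with s ℕ.<? 8
... | yes s<8 = toWitness (allᵇ-sound (λ s → isYes (2^? 2 ∣ (Q₀· Q₀) r s)) 8
                                     (allᵇ-sound Q₀·Q₀-evenᵇ 8 (Equivalence.from T-≡ Q₀·Q₀-even-checked) r<8) s<8)
... | no  s≮8 = 2^∣-resp (sym (sumBelow-zero 8 vanish)) 2^∣0
  where
  vanish : ∀ u → u ℕ.< 8 → Q₀ r u * Q₀ u s ≡ 0ℤ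
  vanish u _ = cong (Q₀ r u *_) (Q₀-vanishes u (ℕP.≮⇒≥ s≮8)) ⟨ trans ⟩ ℤP.*-zeroʳ (Q₀ r u)

Hsub-β-checked : allᵇ (λ s → isYes (2^? β (suc s) ℕ.∸ β s ∣ Hsub s)) 39 ≡ true
Hsub-β-checked = refl

2^β∣scale-<40 : ∀ {s} → s ℕ.< 40 → 2^ β s ∣ scale s
2^β∣scale-<40 {zero}  _          = 2^∣ (Signed.divides (scale 0) (sym (ℤP.*-identityʳ (scale 0))))
2^β∣scale-<40 {suc s} (s≤s s<39) =
  2^∣-weaken (ℕP.m≤n+m∸n (β (suc s)) (β s)) (2^∣-resp (sym (scale-suc s))
    (2^∣-* (2^β∣scale-<40 (ℕP.m≤n⇒m≤1+n s<39))
           (toWitness (allᵇ-sound (λ s → isYes (2^? β (suc s) ℕ.∸ β s ∣ Hsub s)) 39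
                                  (Equivalence.from T-≡ Hsub-β-checked) s<39))))

-- Past s = 38, two more factors (s+1)(s+2) supply a factor 2, while β grows by 1 only every 32 steps.
2^β∣scale-≥38 : ∀ o → 2^ β (38 ℕ.+ o) ∣ scale (38 ℕ.+ o)
2^β∣scale-≥38 0 = 2^β∣scale-<40 (ℕP.m≤m+n 39 1)
2^β∣scale-≥38 1 = 2^β∣scale-<40 ℕP.≤-refl
2^β∣scale-≥38 (suc (suc o)) =
  2^∣-weaken β-bound (2^∣-resp two-steps (2^∣-* (2^β∣scale-≥38 o) (2∣n*[1+n] (39 ℕ.+ o))))
  where
  β-bound : β (40 ℕ.+ o) ℕ.≤ β (38 ℕ.+ o) ℕ.+ 1
  β-bound = ℕP.≤-trans (β-mono (ℕP.≤-trans (ℕP.+-monoˡ-≤ o (ℕP.m≤m+n 40 30))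
                                            (ℕP.≤-reflexive (ℕP.+-comm 32 (38 ℕ.+ o)))))
                       (ℕP.≤-reflexive (β-+32 (ℕP.m≤m+n 38 o) ⟨ trans ⟩ ℕP.+-comm 1 (β (38 ℕ.+ o))))
  two-steps : scale (38 ℕ.+ o) * + ((39 ℕ.+ o) ℕ.* (40 ℕ.+ o)) ≡ scale (40 ℕ.+ o)
  two-steps = begin
    scale (38 ℕ.+ o) * + ((39 ℕ.+ o) ℕ.* (40 ℕ.+ o)) ≡⟨ cong (scale (38 ℕ.+ o) *_) (ℤP.pos-* (39 ℕ.+ o) (40 ℕ.+ o)) ⟩
    scale (38 ℕ.+ o) * (+ (39 ℕ.+ o) * + (40 ℕ.+ o)) ≡⟨ ℤP.*-assoc (scale (38 ℕ.+ o)) (+ (39 ℕ.+ o)) (+ (40 ℕ.+ o)) ⟨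
    scale (38 ℕ.+ o) * + (39 ℕ.+ o) * + (40 ℕ.+ o)   ≡⟨ cong (_* + (40 ℕ.+ o)) (scale-suc (38 ℕ.+ o)) ⟨
    scale (39 ℕ.+ o) * + (40 ℕ.+ o)                  ≡⟨ scale-suc (39 ℕ.+ o) ⟨
    scale (40 ℕ.+ o)                                 ∎
    where open ≡-Reasoning

2^β∣scale : ∀ s → 2^ β s ∣ scale s
2^β∣scale s = split (38 ℕ.≤? s)
  where
  split : Dec (38 ℕ.≤ s) → 2^ β s ∣ scale s
  split (yes 38≤s) = subst (λ x → 2^ β x ∣ scale x) (ℕP.m+[n∸m]≡n 38≤s) (2^β∣scale-≥38 (s ℕ.∸ 38))
  split (no  38≰s) = 2^β∣scale-<40 (ℕP.m<n⇒m<1+n (ℕP.m<n⇒m<1+n (ℕP.≰⇒> 38≰s)))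

-- H^48 ≡ I modulo 2 on all rows

·H-periodic : ∀ {m} {f f' : ℕ → ℤ} → 2^ 3 ∣ + m → (∀ x → 2^ 3 ∣ f' (x ℕ.+ m) - f x) →
              ∀ o → 2^ 3 ∣ (f' ·H) (8 ℕ.+ o ℕ.+ m) - (f ·H) (8 ℕ.+ o)
·H-periodic {m} {f} {f'} 8∣m f'≡f o =
  2^∣-resp (sym regroup)
    (2^∣-+ (2^∣-- (2^∣-+ (2^∣-*ˡ (+ m + + (9 ℕ.+ o)) (f'≡f (9 ℕ.+ o)))
                         (2^∣-*ˡ (+ m + + (7 ℕ.+ o)) (f'≡f (8 ℕ.+ o))))
                  (f'≡f (7 ℕ.+ o)))
           (2^∣-*ˡ (f (9 ℕ.+ o) + f (8 ℕ.+ o)) 8∣m))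
  where
  regroup : (f' ·H) (8 ℕ.+ o ℕ.+ m) - (f ·H) (8 ℕ.+ o) ≡
            (+ m + + (9 ℕ.+ o)) * (f' (9 ℕ.+ o ℕ.+ m) - f (9 ℕ.+ o))
            + (+ m + + (7 ℕ.+ o)) * (f' (8 ℕ.+ o ℕ.+ m) - f (8 ℕ.+ o))
            - (f' (7 ℕ.+ o ℕ.+ m) - f (7 ℕ.+ o)) + (f (9 ℕ.+ o) + f (8 ℕ.+ o)) * + m
  regroup = cong₂ (λ p q → f' (9 ℕ.+ o ℕ.+ m) * p + f' (8 ℕ.+ o ℕ.+ m) * q + f' (7 ℕ.+ o ℕ.+ m) * -1ℤ
                           - (f (9 ℕ.+ o) * + (9 ℕ.+ o) + f (8 ℕ.+ o) * + (7 ℕ.+ o) + f (7 ℕ.+ o) * -1ℤ))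
                  (ℤP.pos-+ (9 ℕ.+ o) m ⟨ trans ⟩ ℤP.+-comm (+ (9 ℕ.+ o)) (+ m))
                  (ℤP.pos-+ (7 ℕ.+ o) m ⟨ trans ⟩ ℤP.+-comm (+ (7 ℕ.+ o)) (+ m))
            ⟨ trans ⟩ ring (f' (9 ℕ.+ o ℕ.+ m)) (f' (8 ℕ.+ o ℕ.+ m)) (f' (7 ℕ.+ o ℕ.+ m))
                           (f (9 ℕ.+ o)) (f (8 ℕ.+ o)) (f (7 ℕ.+ o)) (+ (9 ℕ.+ o)) (+ (7 ℕ.+ o)) (+ m)
    where
    ring : ∀ a' b' c' a b c u v w → a' * (w + u) + b' * (w + v) + c' * -1ℤ - (a * u + b * v + c * -1ℤ) ≡
                                    (w + u) * (a' - a) + (w + v) * (b' - b) - (c' - c) + (a + b) * w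
    ring = solve-∀

H^-periodic : ∀ k {m t} → 2^ 3 ∣ + m → k ℕ.+ 9 ℕ.≤ t →
              ∀ s → 2^ 3 ∣ H^ k [ t ℕ.+ m , s ℕ.+ m ] - H^ k [ t , s ]
H^-periodic zero    {m} {t} _ _ s =
  2^∣-resp (sym (cong (_- δ t s) (δ-+ m t s) ⟨ trans ⟩ ℤP.+-inverseʳ (δ t s))) 2^∣0
H^-periodic (suc k) {m} {t} 8∣m k+10≤t s = split (8 ℕ.≤? s)
  where
  Goal : ℕ → Set
  Goal s = 2^ 3 ∣ H^ suc k [ t ℕ.+ m , s ℕ.+ m ] - H^ suc k [ t , s ]
  split : Dec (8 ℕ.≤ s) → Goal s
  split (yes 8≤s) = subst Goal (ℕP.m+[n∸m]≡n 8≤s)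
                          (·H-periodic {f = δ t ·H^ k} {δ (t ℕ.+ m) ·H^ k} 8∣m
                                       (H^-periodic k 8∣m (ℕP.<⇒≤ k+10≤t)) (s ℕ.∸ 8))
  split (no  8≰s) = 2^∣-resp (sym (cong₂ _-_ (H^-vanishes (suc k) {t ℕ.+ m} {s ℕ.+ m} (shifted below))
                                             (H^-vanishes (suc k) below))) 2^∣0
    where
    below : s ℕ.+ suc k ℕ.< t
    below = ℕP.<-≤-trans (ℕP.+-monoˡ-< (suc k) (ℕP.≰⇒> 8≰s))
                         (ℕP.≤-trans (ℕP.≤-reflexive (ℕP.+-comm 8 (suc k)))
                                     (ℕP.≤-trans (ℕP.+-monoʳ-≤ (suc k) (ℕP.n≤1+n 8)) k+10≤t))
    shifted : s ℕ.+ suc k ℕ.< t → s ℕ.+ m ℕ.+ suc k ℕ.< t ℕ.+ m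
    shifted lt = subst (ℕ._< t ℕ.+ m) (swap s (suc k) m) (ℕP.+-monoˡ-< m lt)
      where
      swap : ∀ a b c → a ℕ.+ b ℕ.+ c ≡ a ℕ.+ c ℕ.+ b
      swap = ℕSolver.solve-∀

-- The shift by 32 raises the weight of the row by one and that of the column by at least one,
-- while the entry itself only changes by a multiple of 8 (H^-periodic).
H^48≡I-entry-+32 : ∀ {t s} → 57 ℕ.≤ t → 9 ℕ.≤ s → t ℕ.+ 32 ℕ.≤ s ℕ.+ 32 ℕ.+ 48 → H^ 48 ≡I-row t →
                   2^ suc (β (t ℕ.+ 32)) ∣ pow2 (β (s ℕ.+ 32)) * (H^ 48 [ t ℕ.+ 32 , s ℕ.+ 32 ] - δ (t ℕ.+ 32) (s ℕ.+ 32))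
H^48≡I-entry-+32 {t} {s} 57≤t 9≤s close IH =
  subst (λ b → 2^ suc b ∣ B * E (t ℕ.+ 32) (s ℕ.+ 32)) (sym (β-+32 (ℕP.≤-trans (ℕP.m≤m+n 38 19) 57≤t)))
        (2^∣-resp (recombine B (E t s) (E (t ℕ.+ 32) (s ℕ.+ 32))) (2^∣-+ unshifted shift))
  where
  E : ℕ → ℕ → ℤ
  E a b = H^ 48 [ a , b ] - δ a b
  B = pow2 (β (s ℕ.+ 32))
  recombine : ∀ b e e' → b * e + b * (e' - e) ≡ b * e'
  recombine = solve-∀
  unshifted : 2^ suc (suc (β t)) ∣ B * E t s
  unshifted = 2^∣-weaken (ℕP.+-monoˡ-≤ (suc (β t)) (ℕP.m<n⇒0<n∸m (β-+32-mono 9≤s)))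
                         (2^∣-rescale (β-mono (ℕP.m≤m+n s 32)) (IH s))
  periodic : 2^ 3 ∣ E (t ℕ.+ 32) (s ℕ.+ 32) - E t s
  periodic = 2^∣-resp (sym (cong (λ d → H^ 48 [ t ℕ.+ 32 , s ℕ.+ 32 ] - d - E t s) (δ-+ 32 t s)
                            ⟨ trans ⟩ cancel (H^ 48 [ t ℕ.+ 32 , s ℕ.+ 32 ]) (H^ 48 [ t , s ]) (δ t s)))
                      (H^-periodic 48 {32} {t} (2^∣ (Signed.divides (+ 4) refl)) 57≤t s)
    where
    cancel : ∀ a b d → a - d - (b - d) ≡ a - b
    cancel = solve-∀
  t≤s+64 : t ℕ.≤ s ℕ.+ 32 ℕ.+ 32
  t≤s+64 = ℕP.+-cancelʳ-≤ 32 t (s ℕ.+ 32 ℕ.+ 32)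
             (ℕP.≤-trans close (ℕP.≤-trans (ℕP.+-monoʳ-≤ (s ℕ.+ 32) (ℕP.m≤m+n 48 16))
                                           (ℕP.≤-reflexive (sym (ℕP.+-assoc (s ℕ.+ 32) 32 32)))))
  bound : suc (suc (β t)) ℕ.≤ β (s ℕ.+ 32) ℕ.+ 3
  bound = ℕP.≤-trans (s≤s (s≤s (ℕP.≤-trans (β-mono t≤s+64) (ℕP.≤-reflexive (β-+32 38≤s+32)))))
                     (ℕP.≤-reflexive (ℕP.+-comm 3 (β (s ℕ.+ 32))))
    where 38≤s+32 = ℕP.≤-trans (ℕP.m≤m+n 38 3) (ℕP.+-monoˡ-≤ 32 9≤s)
  shift : 2^ suc (suc (β t)) ∣ B * (E (t ℕ.+ 32) (s ℕ.+ 32) - E t s)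
  shift = 2^∣-weaken bound (2^∣-* (2^∣2^ (β (s ℕ.+ 32))) periodic)

H^48≡I-row-+32 : ∀ {t} → 57 ℕ.≤ t → H^ 48 ≡I-row t → H^ 48 ≡I-row (t ℕ.+ 32)
H^48≡I-row-+32 {t} 57≤t IH s = split (s ℕ.+ 48 ℕ.<? t ℕ.+ 32)
  where
  Goal : ℕ → Set
  Goal s = 2^ suc (β (t ℕ.+ 32)) ∣ pow2 (β s) * (H^ 48 [ t ℕ.+ 32 , s ] - δ (t ℕ.+ 32) s)
  split : Dec (s ℕ.+ 48 ℕ.< t ℕ.+ 32) → Goal s
  split (yes far) = 2^∣-resp (sym (cong₂ (λ x y → pow2 (β s) * (x - y)) (H^-vanishes 48 {t ℕ.+ 32} {s} far) (δ-≢ t+32≢s)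
                                   ⟨ trans ⟩ ℤP.*-zeroʳ (pow2 (β s)))) 2^∣0
    where
    t+32≢s : t ℕ.+ 32 ≢ s
    t+32≢s t+32≡s = ℕP.<-irrefl (sym t+32≡s) (ℕP.≤-<-trans (ℕP.m≤m+n s 48) far)
  split (no  close) =
    subst Goal (ℕP.m∸n+n≡m 32≤s)
          (H^48≡I-entry-+32 57≤t (ℕP.∸-monoˡ-≤ 32 41≤s)
                            (subst (λ x → t ℕ.+ 32 ℕ.≤ x ℕ.+ 48) (sym (ℕP.m∸n+n≡m 32≤s)) t+32≤s+48) IH)
    where
    t+32≤s+48 = ℕP.≮⇒≥ close
    41≤s : 41 ℕ.≤ s
    41≤s = ℕP.+-cancelʳ-≤ 48 41 s (ℕP.≤-trans (ℕP.+-monoˡ-≤ 32 57≤t) t+32≤s+48)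
    32≤s = ℕP.≤-trans (ℕP.m≤m+n 32 9) 41≤s

H^48≡I : ∀ t → H^ 48 ≡I-row t
H^48≡I = <-rec (H^ 48 ≡I-row_) step
  where
  step : ∀ t → (∀ {t'} → t' ℕ.< t → H^ 48 ≡I-row t') → H^ 48 ≡I-row t
  step t IH = split (t ℕ.<? 89)
    where
    split : Dec (t ℕ.< 89) → H^ 48 ≡I-row t
    split (yes t<89) = H^48≡I-row-<89 t<89
    split (no  t≮89) = subst (H^ 48 ≡I-row_) (ℕP.m∸n+n≡m 32≤t)
                             (H^48≡I-row-+32 (ℕP.∸-monoˡ-≤ 32 89≤t) (IH (ℕP.∸-monoʳ-< {o = 0} (s≤s z≤n) 32≤t)))
      where
      89≤t = ℕP.≮⇒≥ t≮89
      32≤t = ℕP.≤-trans (ℕP.m≤m+n 32 57) 89≤t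

-- Composing approximations of powers of H

-- (f ·H^ k − f) s = Σ_t f t · (H^k − I)(t,s), and the weight of f t plus that of (H^k − I)(t,s)
-- is one more than what the weight of column s requires.
·H^-gain : ∀ {k j} f → (∀ t → H^ k ≡I-row t) → 2^ j ∣ᵝ f → 2^ suc j ∣ᵝ (λ s → (f ·H^ k) s - f s)
·H^-gain {k} {j} f H^k≡I f∣ s = 2^∣-resp (sym expand) (2^∣-sumBelow N terms (λ t _ → term t))
  where
  N = suc (k ℕ.+ s)
  E : ℕ → ℤ
  E t = H^ k [ t , s ] - δ t s
  terms : ℕ → ℤ
  terms t = pow2 (β s) * (f t * E t)
  distrib : ∀ x a b → x * (a - b) ≡ x * a - x * b
  distrib = solve-∀
  expand : pow2 (β s) * ((f ·H^ k) s - f s) ≡ sumBelow N terms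
  expand = cong (pow2 (β s) *_)
             (cong₂ _-_ (·H^-expand k f ℕP.≤-refl) (sym (sumBelow-δ N f (s≤s (ℕP.m≤n+m s k))))
              ⟨ trans ⟩ sym (sumBelow-- N (λ t → f t * H^ k [ t , s ]) (λ t → f t * δ t s))
              ⟨ trans ⟩ sumBelow-cong N (λ t _ → sym (distrib (f t) (H^ k [ t , s ]) (δ t s))))
           ⟨ trans ⟩ sym (sumBelow-*ˡ N (pow2 (β s)) (λ t → f t * E t))
  term : ∀ t → 2^ suc j ∣ terms t
  term t = 2^∣-cancel (β t) (terms t)
             (subst (2^_∣ pow2 (β t) * terms t) (exponent j (β t))
                    (2^∣-resp (regroup (pow2 (β t)) (f t) (pow2 (β s)) (E t)) (2^∣-* (f∣ t) (H^k≡I t s))))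
    where
    exponent : ∀ j b → j ℕ.+ suc b ≡ b ℕ.+ suc j
    exponent = ℕSolver.solve-∀
    regroup : ∀ p x q e → p * x * (q * e) ≡ p * (q * (x * e))
    regroup = solve-∀

·H^-gain-iterate : ∀ {k j} f → (∀ t → H^ k ≡I-row t) → 2^ j ∣ᵝ f →
                   ∀ n → 2^ suc j ∣ᵝ (λ s → (f ·H^ (n ℕ.* k)) s - f s)
·H^-gain-iterate f H^k≡I f∣ zero    s =
  2^∣-resp (sym (cong (pow2 (β s) *_) (ℤP.+-inverseʳ (f s)) ⟨ trans ⟩ ℤP.*-zeroʳ (pow2 (β s)))) 2^∣0
·H^-gain-iterate {k} {j} f H^k≡I f∣ (suc n) s =
  2^∣-resp (sym split) (2^∣-+ (·H^-gain {k} g H^k≡I g∣ s) (·H^-gain-iterate {k} f H^k≡I f∣ n s))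
  where
  g = f ·H^ (n ℕ.* k)
  g∣ : 2^ j ∣ᵝ g
  g∣ x = 2^∣-resp (recombine (pow2 (β x)) (f x) (g x))
                  (2^∣-+ (f∣ x) (2^∣-weaken (ℕP.n≤1+n j) (·H^-gain-iterate {k} f H^k≡I f∣ n x)))
    where
    recombine : ∀ p a b → p * a + p * (b - a) ≡ p * b
    recombine = solve-∀
  split : pow2 (β s) * ((f ·H^ (k ℕ.+ n ℕ.* k)) s - f s) ≡ pow2 (β s) * ((g ·H^ k) s - g s) + pow2 (β s) * (g s - f s)
  split = cong (λ x → pow2 (β s) * (x - f s)) (·H^-exponent-+ k (n ℕ.* k) f s)
          ⟨ trans ⟩ telescope (pow2 (β s)) ((g ·H^ k) s) (g s) (f s)
    where
    telescope : ∀ p a b c → p * (a - c) ≡ p * (a - b) + p * (b - c)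
    telescope = solve-∀

H^-split : ∀ e a r s → H^ e [ r , s ] ≡ δ r s + a * Q₀ r s + deviation e a r s
H^-split e a r s = regroup (H^ e [ r , s ]) (δ r s + a * Q₀ r s)
  where
  regroup : ∀ h d → h ≡ d + (h - d)
  regroup = solve-∀

Q₀-row-·H^ : ∀ e a r s → (Q₀ r ·H^ e) s ≡ Q₀ r s + a * (Q₀· Q₀) r s + (Q₀· deviation e a) r s
Q₀-row-·H^ e a r s = begin
  (Q₀ r ·H^ e) s
    ≡⟨ ·H^-expand e (Q₀ r) (ℕP.m≤n+m (suc (e ℕ.+ s)) 8) ⟩
  sumBelow N (λ u → Q₀ r u * H^ e [ u , s ])
    ≡⟨ sumBelow-cong N (λ u _ → cong (Q₀ r u *_) (H^-split e a u s)
                                 ⟨ trans ⟩ distribute (Q₀ r u) (δ u s) a (Q₀ u s) (deviation e a u s)) ⟩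
  sumBelow N (λ u → Q₀ r u * δ u s + a * (Q₀ r u * Q₀ u s) + Q₀ r u * deviation e a u s)
    ≡⟨ sumBelow-+ N (λ u → Q₀ r u * δ u s + a * (Q₀ r u * Q₀ u s)) (λ u → Q₀ r u * deviation e a u s)
       ⟨ trans ⟩ cong (_+ sumBelow N (λ u → Q₀ r u * deviation e a u s))
                      (sumBelow-+ N (λ u → Q₀ r u * δ u s) (λ u → a * (Q₀ r u * Q₀ u s))) ⟩
  sumBelow N (λ u → Q₀ r u * δ u s) + sumBelow N (λ u → a * (Q₀ r u * Q₀ u s))
    + sumBelow N (λ u → Q₀ r u * deviation e a u s)
    ≡⟨ cong₂ _+_ (cong₂ _+_ (sumBelow-δ N (Q₀ r) (s≤s (ℕP.≤-trans (ℕP.m≤n+m s e) (ℕP.m≤n+m (e ℕ.+ s) 8))))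
                            (sumBelow-*ˡ N a (λ u → Q₀ r u * Q₀ u s) ⟨ trans ⟩ cong (a *_) (truncate (λ u → Q₀ u s))))
                 (truncate (λ u → deviation e a u s)) ⟩
  Q₀ r s + a * (Q₀· Q₀) r s + (Q₀· deviation e a) r s
    ∎
  where
  open ≡-Reasoning
  N = 8 ℕ.+ suc (e ℕ.+ s)
  distribute : ∀ q d a q' x → q * (d + a * q' + x) ≡ q * d + a * (q * q') + q * x
  distribute = solve-∀
  truncate : ∀ (g : ℕ → ℤ) → sumBelow N (λ u → Q₀ r u * g u) ≡ sumBelow 8 (λ u → Q₀ r u * g u)
  truncate g = sumBelow-extend {8} {N} (λ u → Q₀ r u * g u) (ℕP.m≤m+n 8 (suc (e ℕ.+ s)))
                               (λ u 8≤u → cong (_* g u) (Q₀-vanishes r 8≤u) ⟨ trans ⟩ ℤP.*-zeroˡ (g u))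

-- Row r of H^(e₂+e₁) = (I + a₁Q₀ + D₁) H^e₂ with H^e₂ = I + a₂Q₀ + D₂, where the terms involving D₁
-- other than D₁ itself are collected in D₁ (H^e₂ − I).
deviation-+ : ∀ e₁ e₂ a₁ a₂ r s →
  deviation (e₂ ℕ.+ e₁) (a₁ + a₂) r s ≡
    deviation e₂ a₂ r s + a₁ * a₂ * (Q₀· Q₀) r s + a₁ * (Q₀· deviation e₂ a₂) r s + deviation e₁ a₁ r s
    + ((deviation e₁ a₁ r ·H^ e₂) s - deviation e₁ a₁ r s)
deviation-+ e₁ e₂ a₁ a₂ r s = cong (_- (δ r s + (a₁ + a₂) * Q₀ r s)) expand ⟨ trans ⟩
  regroup (δ r s) (Q₀ r s) a₁ a₂ (deviation e₂ a₂ r s) ((Q₀· Q₀) r s) ((Q₀· deviation e₂ a₂) r s)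
          (deviation e₁ a₁ r s) ((deviation e₁ a₁ r ·H^ e₂) s)
  where
  D₁ = deviation e₁ a₁ r
  expand : H^ (e₂ ℕ.+ e₁) [ r , s ] ≡
           δ r s + a₂ * Q₀ r s + deviation e₂ a₂ r s
           + a₁ * (Q₀ r s + a₂ * (Q₀· Q₀) r s + (Q₀· deviation e₂ a₂) r s) + (D₁ ·H^ e₂) s
  expand = begin
    H^ (e₂ ℕ.+ e₁) [ r , s ]
      ≡⟨ ·H^-exponent-+ e₂ e₁ (δ r) s ⟩
    ((δ r ·H^ e₁) ·H^ e₂) s
      ≡⟨ ·H^-cong e₂ (H^-split e₁ a₁ r) s ⟩
    ((λ x → δ r x + a₁ * Q₀ r x + D₁ x) ·H^ e₂) s
      ≡⟨ ·H^-+ e₂ (λ x → δ r x + a₁ * Q₀ r x) D₁ s ⟩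
    ((λ x → δ r x + a₁ * Q₀ r x) ·H^ e₂) s + (D₁ ·H^ e₂) s
      ≡⟨ cong (_+ (D₁ ·H^ e₂) s) (·H^-+ e₂ (δ r) (λ x → a₁ * Q₀ r x) s
                                  ⟨ trans ⟩ cong (λ x → H^ e₂ [ r , s ] + x) (·H^-* e₂ a₁ (Q₀ r) s)) ⟩
    H^ e₂ [ r , s ] + a₁ * (Q₀ r ·H^ e₂) s + (D₁ ·H^ e₂) s
      ≡⟨ cong₂ (λ h q → h + a₁ * q + (D₁ ·H^ e₂) s) (H^-split e₂ a₂ r s) (Q₀-row-·H^ e₂ a₂ r s) ⟩
    δ r s + a₂ * Q₀ r s + deviation e₂ a₂ r s
      + a₁ * (Q₀ r s + a₂ * (Q₀· Q₀) r s + (Q₀· deviation e₂ a₂) r s) + (D₁ ·H^ e₂) s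
      ∎
    where open ≡-Reasoning
  regroup : ∀ d q a₁ a₂ D₂ QQ QD D₁ X →
            d + a₂ * q + D₂ + a₁ * (q + a₂ * QQ + QD) + X - (d + (a₁ + a₂) * q) ≡
            D₂ + a₁ * a₂ * QQ + a₁ * QD + D₁ + (X - D₁)
  regroup = solve-∀

Q₀·-∣ᵝ : ∀ {K} {M : ℕ → ℕ → ℤ} → (∀ {u} → u ℕ.< 8 → 2^ K ∣ᵝ M u) → ∀ r → 2^ K ∣ᵝ (Q₀· M) r
Q₀·-∣ᵝ {M = M} M∣ r s =
  2^∣-resp (sumBelow-cong 8 (λ u _ → reorder (pow2 (β s)) (Q₀ r u) (M u s))
            ⟨ trans ⟩ sumBelow-*ˡ 8 (pow2 (β s)) (λ u → Q₀ r u * M u s))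
           (2^∣-sumBelow 8 (λ u → Q₀ r u * (pow2 (β s) * M u s)) (λ u u<8 → 2^∣-*ˡ (Q₀ r u) (M∣ u<8 s)))
  where
  reorder : ∀ p q m → q * (p * m) ≡ p * (q * m)
  reorder = solve-∀

compose : ∀ {k K e₁ a₁ a₂} n → (∀ t → H^ k ≡I-row t) →
          H^ e₁ ≡I+ a₁ ·Q₀-mod2^ K → H^ (n ℕ.* k) ≡I+ a₂ ·Q₀-mod2^ K →
          (∀ {r} → r ℕ.< 8 → 2^ K ∣ᵝ (λ s → a₁ * a₂ * (Q₀· Q₀) r s)) →
          H^ (n ℕ.* k ℕ.+ e₁) ≡I+ a₁ + a₂ ·Q₀-mod2^ K
compose {k} {K} {e₁} {a₁} {a₂} n H^k≡I D₁∣ D₂∣ QQ∣ {r} r<8 s =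
  2^∣-resp (sym (cong (pow2 (β s) *_) (deviation-+ e₁ (n ℕ.* k) a₁ a₂ r s)
                 ⟨ trans ⟩ distribute (pow2 (β s)) (deviation (n ℕ.* k) a₂ r s) (a₁ * a₂ * (Q₀· Q₀) r s) a₁
                                      ((Q₀· deviation (n ℕ.* k) a₂) r s) (deviation e₁ a₁ r s)
                                      ((deviation e₁ a₁ r ·H^ (n ℕ.* k)) s - deviation e₁ a₁ r s)))
    (2^∣-+ (2^∣-+ (2^∣-+ (2^∣-+ (D₂∣ r<8 s) (QQ∣ r<8 s)) (2^∣-*ˡ a₁ (Q₀·-∣ᵝ D₂∣ r s))) (D₁∣ r<8 s))
           (2^∣-weaken (ℕP.n≤1+n K) (·H^-gain-iterate {k} (deviation e₁ a₁ r) H^k≡I (D₁∣ r<8) n s)))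
  where
  distribute : ∀ p A B a C D X → p * (A + B + a * C + D + X) ≡ p * A + p * B + a * (p * C) + p * D + p * X
  distribute = solve-∀

double : ∀ {k K a} n → (∀ t → H^ k ≡I-row t) → 2^ 1 ∣ a → H^ (n ℕ.* k) ≡I+ a ·Q₀-mod2^ K →
         (∀ {r} → r ℕ.< 8 → 2^ suc K ∣ᵝ (λ s → a * a * (Q₀· Q₀) r s)) →
         H^ (n ℕ.* k ℕ.+ n ℕ.* k) ≡I+ a + a ·Q₀-mod2^ suc K
double {k} {a = a} n H^k≡I 2∣a D∣ QQ∣ {r} r<8 s =
  2^∣-resp (sym (cong (pow2 (β s) *_) (deviation-+ (n ℕ.* k) (n ℕ.* k) a a r s)
                 ⟨ trans ⟩ distribute (pow2 (β s)) (deviation (n ℕ.* k) a r s) (a * a * (Q₀· Q₀) r s) a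
                                      ((Q₀· deviation (n ℕ.* k) a) r s)
                                      ((deviation (n ℕ.* k) a r ·H^ (n ℕ.* k)) s - deviation (n ℕ.* k) a r s)))
    (2^∣-+ (2^∣-+ (2^∣-+ (2^∣-* (2^∣2^ 1) (D∣ r<8 s)) (QQ∣ r<8 s)) (2^∣-* 2∣a (Q₀·-∣ᵝ D∣ r s)))
           (·H^-gain-iterate {k} (deviation (n ℕ.* k) a r) H^k≡I (D∣ r<8) n s))
  where
  distribute : ∀ p D B a C X → p * (D + B + a * C + D + X) ≡ + 2 * (p * D) + p * B + a * (p * C) + p * X
  distribute = solve-∀

≡I+-cast : ∀ {e e' a a' K K'} → e ≡ e' → a ≡ a' → K ≡ K' →
           H^ e ≡I+ a ·Q₀-mod2^ K → H^ e' ≡I+ a' ·Q₀-mod2^ K'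
≡I+-cast refl refl refl approx = approx

multiple-Q₀·Q₀-∣ᵝ : ∀ {i j a₁ a₂ K} → 2^ i ∣ a₁ → 2^ j ∣ a₂ → K ℕ.≤ i ℕ.+ j ℕ.+ 2 →
                    ∀ {r} → r ℕ.< 8 → 2^ K ∣ᵝ (λ s → a₁ * a₂ * (Q₀· Q₀) r s)
multiple-Q₀·Q₀-∣ᵝ a₁∣ a₂∣ K≤ r<8 s =
  2^∣-*ˡ (pow2 (β s)) (2^∣-weaken K≤ (2^∣-* (2^∣-* a₁∣ a₂∣) (Q₀·Q₀-even r<8 s)))

8+m≤[3+m]+[3+m]+2 : ∀ m → 8 ℕ.+ m ℕ.≤ 3 ℕ.+ m ℕ.+ (3 ℕ.+ m) ℕ.+ 2
8+m≤[3+m]+[3+m]+2 m = ℕP.≤-trans (ℕP.m≤m+n (8 ℕ.+ m) m) (ℕP.≤-reflexive (rearrange m))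
  where
  rearrange : ∀ m → 8 ℕ.+ m ℕ.+ m ≡ 3 ℕ.+ m ℕ.+ (3 ℕ.+ m) ℕ.+ 2
  rearrange = ℕSolver.solve-∀

H^2^m*48 : ∀ m → H^ (2 ℕ.^ m ℕ.* 48) ≡I+ + (2 ℕ.^ (3 ℕ.+ m)) ·Q₀-mod2^ (7 ℕ.+ m)
H^2^m*48 zero    = H^48≡I+8Q₀
H^2^m*48 (suc m) =
  ≡I+-cast {2 ℕ.^ m ℕ.* 48 ℕ.+ 2 ℕ.^ m ℕ.* 48} {2 ℕ.^ suc m ℕ.* 48} {+ A + + A} {+ (2 ℕ.^ (3 ℕ.+ suc m))}
           (exponent (2 ℕ.^ m)) (sym (ℤP.pos-+ A A) ⟨ trans ⟩ cong +_ (double-is-2* A)) refl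
    (double {48} {7 ℕ.+ m} {+ A} (2 ℕ.^ m) H^48≡I (2^∣-weaken (s≤s z≤n) (2^∣2^ (3 ℕ.+ m))) (H^2^m*48 m)
            (multiple-Q₀·Q₀-∣ᵝ (2^∣2^ (3 ℕ.+ m)) (2^∣2^ (3 ℕ.+ m)) (8+m≤[3+m]+[3+m]+2 m)))
  where
  A = 2 ℕ.^ (3 ℕ.+ m)
  exponent : ∀ x → x ℕ.* 48 ℕ.+ x ℕ.* 48 ≡ (2 ℕ.* x) ℕ.* 48
  exponent = ℕSolver.solve-∀
  double-is-2* : ∀ x → x ℕ.+ x ≡ 2 ℕ.* x
  double-is-2* = ℕSolver.solve-∀

H^n*2^m*48 : ∀ m n → H^ (n ℕ.* (2 ℕ.^ m ℕ.* 48)) ≡I+ + (n ℕ.* 2 ℕ.^ (3 ℕ.+ m)) ·Q₀-mod2^ (7 ℕ.+ m)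
H^n*2^m*48 m zero {r} r<8 s =
  2^∣-resp (sym (cong (pow2 (β s) *_) (cancel (δ r s)) ⟨ trans ⟩ ℤP.*-zeroʳ (pow2 (β s)))) 2^∣0
  where
  cancel : ∀ d → d - (d + 0ℤ) ≡ 0ℤ
  cancel = solve-∀
H^n*2^m*48 m (suc n) =
  ≡I+-cast {e = suc n ℕ.* (2 ℕ.^ m ℕ.* 48)} refl
           (sym (ℤP.pos-+ (n ℕ.* A) A) ⟨ trans ⟩ cong +_ (ℕP.+-comm (n ℕ.* A) A)) refl
    (compose {48} {7 ℕ.+ m} {n ℕ.* (2 ℕ.^ m ℕ.* 48)} {+ (n ℕ.* A)} {+ A} (2 ℕ.^ m) H^48≡I (H^n*2^m*48 m n) (H^2^m*48 m)
             (multiple-Q₀·Q₀-∣ᵝ (2^∣n*2^ n (3 ℕ.+ m)) (2^∣2^ (3 ℕ.+ m)) (ℕP.<⇒≤ (8+m≤[3+m]+[3+m]+2 m))))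
  where
  A = 2 ℕ.^ (3 ℕ.+ m)

H^n*d : ∀ n {m} → 4 ℕ.≤ m → H^ (n ℕ.* d m) ≡I+ + (n ℕ.* 2 ℕ.^ (m ℕ.∸ 1)) ·Q₀-mod2^ (m ℕ.+ 3)
H^n*d n {m} 4≤m =
  ≡I+-cast (exponent n (2 ℕ.^ o) ⟨ trans ⟩ cong (λ m → n ℕ.* d m) 4+o≡m)
           (cong (λ m → + (n ℕ.* 2 ℕ.^ (m ℕ.∸ 1))) 4+o≡m)
           (index o ⟨ trans ⟩ cong (ℕ._+ 3) 4+o≡m)
           (H^n*2^m*48 o n)
  where
  o = m ℕ.∸ 4
  4+o≡m = ℕP.m+[n∸m]≡n 4≤m
  exponent : ∀ n x → n ℕ.* (x ℕ.* 48) ≡ n ℕ.* (3 ℕ.* (2 ℕ.* (2 ℕ.* (2 ℕ.* (2 ℕ.* x)))))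
  exponent = ℕSolver.solve-∀
  index : ∀ o → 7 ℕ.+ o ≡ 4 ℕ.+ o ℕ.+ 3
  index = ℕSolver.solve-∀

Q≡Q₀-mod16 : ∀ r s q → r ℕ.< 8 → s ℕ.< 8 → + (2 ℕ.^ 7) ∣ Ppow 48 r s - (δ r s + + 8 * q) → 2^ 4 ∣ q - Q₀ r s
Q≡Q₀-mod16 r s q r<8 s<8 hyp =
  2^∣-cancel 3 (q - Q₀ r s)
    (2^∣-resp (difference (H^ 48 [ r , s ]) (δ r s) q (Q₀ r s))
      (2^∣-- (unweight-≤7 s (H^ 48 [ r , s ] - (δ r s + + 8 * Q₀ r s)) (ℕP.≤-pred s<8) (H^48≡I+8Q₀ r<8 s))
             (subst (λ p → 2^ 7 ∣ p - (δ r s + + 8 * q)) (Ppow-≡-H^ 48 (ℕP.≤-pred r<8) (ℕP.≤-pred s<8))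
                    (2^∣ (Signed.∣ᵤ⇒∣ {pow2 7} {Ppow 48 r s - (δ r s + + 8 * q)} hyp)))))
  where
  difference : ∀ h d q q₀ → h - (d + + 8 * q₀) - (h - (d + + 8 * q)) ≡ + 8 * (q - q₀)
  difference = solve-∀

Ppow-top-left : ∀ n {m r s} q → 4 ℕ.≤ m → r ℕ.< 8 → s ℕ.< 8 → 2^ 4 ∣ q - Q₀ r s →
                2^ (m ℕ.+ 3) ∣ Ppow (n ℕ.* d m) r s - (δ r s + + (n ℕ.* 2 ℕ.^ (m ℕ.∸ 1)) * q)
Ppow-top-left n {m} {r} {s} q 4≤m r<8 s<8 q≡Q₀ =
  2^∣-resp (replace (Ppow (n ℕ.* d m) r s) (δ r s) A q (Q₀ r s))
    (2^∣-- (subst (λ p → 2^ (m ℕ.+ 3) ∣ p - (δ r s + A * Q₀ r s))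
                  (sym (Ppow-≡-H^ (n ℕ.* d m) (ℕP.≤-pred r<8) (ℕP.≤-pred s<8)))
                  (unweight-≤7 s (deviation (n ℕ.* d m) A r s) (ℕP.≤-pred s<8) (H^n*d n 4≤m r<8 s)))
           (subst (2^_∣ A * (q - Q₀ r s)) index (2^∣-* (2^∣n*2^ n (m ℕ.∸ 1)) q≡Q₀)))
  where
  A = + (n ℕ.* 2 ℕ.^ (m ℕ.∸ 1))
  replace : ∀ p d a q q₀ → p - (d + a * q₀) - a * (q - q₀) ≡ p - (d + a * q)
  replace = solve-∀
  index : m ℕ.∸ 1 ℕ.+ 4 ≡ m ℕ.+ 3
  index = sym (ℕP.+-assoc (m ℕ.∸ 1) 1 3) ⟨ trans ⟩ cong (ℕ._+ 3) (ℕP.m∸n+n≡m (ℕP.≤-trans (s≤s z≤n) 4≤m))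

Ppow-top-right : ∀ n {m r s} → 4 ℕ.≤ m → r ℕ.< 8 → 8 ℕ.≤ s → 2^ (m ℕ.+ 3) ∣ Ppow (n ℕ.* d m) r s
Ppow-top-right n {m} {r} {s} 4≤m r<8 8≤s =
  2^∣-resp conjugate (2^∣-*ˡ q (2^∣-resp (cong (pow2 (β s) *_) deviation≡H^) (H^n*d n 4≤m r<8 s)))
  where
  N = n ℕ.* d m
  A = + (n ℕ.* 2 ℕ.^ (m ℕ.∸ 1))
  q = Signed._∣_.quotient (2^_∣_.proof (2^β∣scale s))
  deviation≡H^ : deviation N A r s ≡ H^ N [ r , s ]
  deviation≡H^ = cong₂ (λ x y → H^ N [ r , s ] - (x + A * y))
                       (δ-≢ (ℕP.<⇒≢ (ℕP.<-≤-trans r<8 8≤s))) (Q₀-vanishes r 8≤s)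
                 ⟨ trans ⟩ cleanup (H^ N [ r , s ]) A
    where
    cleanup : ∀ h a → h - (0ℤ + a * 0ℤ) ≡ h
    cleanup = solve-∀
  conjugate : q * (pow2 (β s) * H^ N [ r , s ]) ≡ Ppow N r s
  conjugate = sym (ℤP.*-assoc q (pow2 (β s)) (H^ N [ r , s ]))
              ⟨ trans ⟩ cong (_* H^ N [ r , s ]) (sym (Signed._∣_.equality (2^_∣_.proof (2^β∣scale s))))
              ⟨ trans ⟩ sym (Ppow-conj N s (ℕP.≤-pred r<8))

corollary5p9 : (Q : Fin 8 → Fin 8 → ℤ) →
    (∀ r s → (+ 0 ≤ Q r s) × (Q r s < + 16)) →
    (∀ r s → + (2 ℕ.^ 7) ∣ (Ppow 48 (toℕ r) (toℕ s) - (δ (toℕ r) (toℕ s) + + 8 * Q r s))) →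
    ∀ (n m : ℕ) → 1 ℕ.≤ n → 4 ℕ.≤ m →
      (∀ (r s : Fin 8) →
        + (2 ℕ.^ (m ℕ.+ 3)) ∣
          (Ppow (n ℕ.* d m) (toℕ r) (toℕ s)
            - (δ (toℕ r) (toℕ s) + + (n ℕ.* 2 ℕ.^ (m ℕ.∸ 1)) * Q r s)))
      × (∀ (r s : ℕ) → r ℕ.≤ 7 → 8 ℕ.≤ s →
        + (2 ℕ.^ (m ℕ.+ 3)) ∣ Ppow (n ℕ.* d m) r s)
corollary5p9 Q _ hyp n m _ 4≤m = top-left , top-right
  where
  top-left : ∀ r s → + (2 ℕ.^ (m ℕ.+ 3)) ∣
             (Ppow (n ℕ.* d m) (toℕ r) (toℕ s) - (δ (toℕ r) (toℕ s) + + (n ℕ.* 2 ℕ.^ (m ℕ.∸ 1)) * Q r s))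
  top-left r s = 2^∣⇒∣ (Ppow-top-left n (Q r s) 4≤m (toℕ<n r) (toℕ<n s)
                                      (Q≡Q₀-mod16 (toℕ r) (toℕ s) (Q r s) (toℕ<n r) (toℕ<n s) (hyp r s)))
  top-right : ∀ r s → r ℕ.≤ 7 → 8 ℕ.≤ s → + (2 ℕ.^ (m ℕ.+ 3)) ∣ Ppow (n ℕ.* d m) r s
  top-right r s r≤7 8≤s = 2^∣⇒∣ (Ppow-top-right n 4≤m (s≤s r≤7) 8≤s)
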